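{- Let $\lambda$ be a partition, $w\in S_\infty$ and $U\in{\sf EG}(\lambda,w)$. If ${\sf Label}_U(x,y)={\sf Label}_U(c,d)$ for cells $(x,y),(c,d)$ of $\lambda$, then ${\sf Label}_{{\sf sweep}({\sf std}(U))}(x,y)={\sf Label}_{{\sf sweep}({\sf std}(U))}(c,d)$.
   Context: $s_i$ is the simple transposition swapping $i,i+1$ in $S_\infty=\bigcup_m S_m$; a reduced word of $w$ is an expression of $w$ as a product of $\ell(w)$ simple transpositions, $\ell(w)$ being the Coxeter length. Cells of the Young diagram of $\lambda$ (English convention) have matrix coordinates $(x,y)$ (row $x$, column $y$), and ${\sf Label}_U(x,y)$ is the entry of a filling $U$ in cell $(x,y)$. ${\sf EG}(\lambda,w)$ is the set of fillings of $\lambda$ by positive integers strictly increasing along rows and down columns such that, reading the entries row by row from top to bottom, each row from right to left, as $i_1,\dots,i_{|\lambda|}$, the product $s_{i_1}\cdots s_{i_{|\lambda|}}$ is a reduced word of $w$. Standardization ${\sf std}$: for such a tableau with $k_j$ entries equal to $j$, replace the entries equal to $1$, from left to right, by $1,\dots,k_1$, then the entries originally equal to $2$, from left to right, by $k_1+1,\dots,k_1+k_2$, etc., giving a standard Young tableau. For a standard Young tableau $V$, a descent is a label $j$ such that $j-1$ lies weakly east (hence strictly north) of $j$; ${\sf sweep}(V)$ is the filling with ${\sf Label}_{{\sf sweep}(V)}(x,y)=|\{k\le{\sf Label}_V(x,y): k\text{ a descent of }V\}|+1$. -}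

module Defs where

open import Data.Nat using (ℕ; zero; suc; _+_; _<_; _≤_; _≡ᵇ_; _<ᵇ_; _≤ᵇ_)
open import Data.Bool using (Bool; true; false; _∧_; _∨_; if_then_else_)
open import Data.List using (List; []; _∷_; length; map; concat; concatMap; reverse; upTo; filterᵇ)
open import Data.Bool.ListAction using (any)
open import Data.List.Relation.Unary.All using (All)
open import Data.List.Relation.Unary.Linked using (Linked)
open import Data.Product using (_×_; _,_; ∃)
open import Relation.Binary.PropositionalEquality using (_≡_)

Partition : List ℕ → Set
Partition λ′ = Linked (λ a b → b ≤ a) λ′ × All (λ a → 0 < a) λ′

at : {A : Set} → A → List A → ℕ → A
at d []       _       = d
at d (a ∷ as) zero    = a
at d (a ∷ as) (suc n) = at d as n

-- Fillings are lists of rows (English convention, top row first).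
-- Cells are indexed (x , y) = (row , column), 0-based.
Filling : Set
Filling = List (List ℕ)

Label : Filling → ℕ → ℕ → ℕ
Label U x y = at 0 (at [] U x) y

InShape : List ℕ → ℕ → ℕ → Set
InShape λ′ x y = x < length λ′ × y < at 0 λ′ x

cells : Filling → List (ℕ × ℕ)
cells U = concatMap (λ x → map (λ y → x , y) (upTo (length (at [] U x)))) (upTo (length U))

mapCells : (ℕ → ℕ → ℕ) → Filling → Filling
mapCells f U = map (λ x → map (λ y → f x y) (upTo (length (at [] U x)))) (upTo (length U))

countᵇ : {A : Set} → (A → Bool) → List A → ℕ
countᵇ p xs = length (filterᵇ p xs)

-- Simple transpositions and products, acting on ℕ (positive integers
-- 1,2,3,…; the point 0 is always fixed).

s : ℕ → ℕ → ℕ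
s i n = if n ≡ᵇ i then suc i else (if n ≡ᵇ suc i then i else n)

prod : List ℕ → ℕ → ℕ
prod []       n = n
prod (i ∷ is) n = s i (prod is n)

InS∞ : (ℕ → ℕ) → Set
InS∞ w = (w 0 ≡ 0)
       × (∀ m n → w m ≡ w n → m ≡ n)
       × ∃ (λ N → ∀ n → N ≤ n → w n ≡ n)

IsWordOf : List ℕ → (ℕ → ℕ) → Set
IsWordOf a w = All (λ i → 1 ≤ i) a × (∀ n → prod a n ≡ w n)

IsReducedWordOf : List ℕ → (ℕ → ℕ) → Set
IsReducedWordOf a w = IsWordOf a w × (∀ b → IsWordOf b w → length a ≤ length b)

readingWord : Filling → List ℕ
readingWord U = concatMap reverse U

EG : List ℕ → (ℕ → ℕ) → Filling → Set
EG λ′ w U =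
    (map length U ≡ λ′)
  × (∀ x y → InShape λ′ x y → 1 ≤ Label U x y)
  × (∀ x y → InShape λ′ x y → InShape λ′ x (suc y) → Label U x y < Label U x (suc y))
  × (∀ x y → InShape λ′ x y → InShape λ′ (suc x) y → Label U x y < Label U (suc x) y)
  × IsReducedWordOf (readingWord U) w

stdLabel : Filling → ℕ → ℕ → ℕ
stdLabel U x y =
  let v = Label U x y in
  suc (countᵇ (λ { (a , b) → (Label U a b <ᵇ v) ∨ ((Label U a b ≡ᵇ v) ∧ (b <ᵇ y)) }) (cells U))

std : Filling → Filling
std U = mapCells (stdLabel U) U

-- Descents and sweep of a standard Young tableau V:
-- j is a descent iff j-1 lies weakly east of j (column of j-1 ≥ column of j)

isDescent : Filling → ℕ → Bool
isDescent V j =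
  any (λ { (a , b) → any (λ { (c , d) →
        (suc (Label V a b) ≡ᵇ j) ∧ (Label V c d ≡ᵇ j) ∧ (d ≤ᵇ b) }) (cells V) }) (cells V)

sweepLabel : Filling → ℕ → ℕ → ℕ
sweepLabel V x y = suc (countᵇ (isDescent V) (map suc (upTo (Label V x y))))

sweep : Filling → Filling
sweep V = mapCells (sweepLabel V) V

-- Standardization ranks the cells lexicographically by (entry, column). Hence every label of
-- std U lying between the labels of two cells carrying the same entry v belongs to a cell
-- carrying v, and among those cells the label grows with the column. So for labels j in such
-- a range, j − 1 never lies weakly east of j: there is no descent, and sweep, which counts
-- descents up to the label, takes one value on the cells carrying v.
module Submission where

open import Defs
open import Data.Nat using (ℕ; zero; suc; _<_; _≤_; _≤′_; ≤′-refl; ≤′-step; _≡ᵇ_; _<ᵇ_; z≤n; s≤s)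
open import Data.Nat.Properties
  using (≤-refl; ≤-pred; <⇒≤; <-≤-trans; <-trans; <-cmp; <⇒≱; 1+n≰n; m≤n⇒m≤1+n; ≤-total; ≤⇒≤′; ≤′⇒≤; <ᵇ⇒<; <⇒<ᵇ; ≡ᵇ⇒≡; ≡⇒≡ᵇ; ≤ᵇ⇒≤; module ≤-Reasoning)
open import Data.Bool using (Bool; true; false; T; _∧_; _∨_)
open import Data.Bool.Properties using (T-∨; T-∧)
open import Data.List using (List; []; _∷_; [_]; length; map; concat; upTo; applyUpTo; _∷ʳ_; _++_)
open import Data.List.Properties using (length-map; length-upTo; map-upTo; upTo-∷ʳ; map-++; map-cong-local)
open import Data.List.Relation.Unary.All using (tabulate)
open import Data.List.Relation.Unary.Any using (here; there)
open import Data.List.Relation.Unary.Any.Properties using (any⁻)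
open import Data.List.Membership.Propositional using (_∈_; find; lose)
open import Data.List.Membership.Propositional.Properties using (∈-concatMap⁺; ∈-concatMap⁻; ∈-map⁺; ∈-map⁻; ∈-upTo⁺; ∈-upTo⁻)
open import Data.Product using (_×_; _,_)
open import Data.Sum using (inj₁; inj₂)
open import Data.Empty using (⊥-elim)
open import Function.Base using (_∘_)
open import Function.Bundles using (Equivalence)
open import Relation.Binary.Definitions using (tri<; tri≈; tri>)
open import Relation.Nullary using (¬_)
open import Relation.Binary.PropositionalEquality using (_≡_; refl; sym; trans; cong; subst; module ≡-Reasoning)

at-applyUpTo : {A : Set} (d : A) (f : ℕ → A) {n x : ℕ} → x < n → at d (applyUpTo f n) x ≡ f x
at-applyUpTo d f {suc n} {zero}  _         = refl
at-applyUpTo d f {suc n} {suc x} (s≤s x<n) = at-applyUpTo d (λ k → f (suc k)) x<n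

at-map-upTo : {A : Set} (d : A) (f : ℕ → A) {n x : ℕ} → x < n → at d (map f (upTo n)) x ≡ f x
at-map-upTo d f {n} x<n rewrite map-upTo f n = at-applyUpTo d f x<n

at-map-length : (U : Filling) (x : ℕ) → at 0 (map length U) x ≡ length (at [] U x)
at-map-length []      x       = refl
at-map-length (r ∷ U) zero    = refl
at-map-length (r ∷ U) (suc x) = at-map-length U x

∈-cells⁻ : (U : Filling) {x y : ℕ} → (x , y) ∈ cells U → x < length U × y < length (at [] U x)
∈-cells⁻ U cell with find (∈-concatMap⁻ _ {xs = upTo (length U)} cell)
... | x , x∈ , y∈row with ∈-map⁻ _ y∈row
... | y , y∈ , refl = ∈-upTo⁻ x∈ , ∈-upTo⁻ y∈

∈-cells⁺ : (U : Filling) {x y : ℕ} → x < length U → y < length (at [] U x) → (x , y) ∈ cells U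
∈-cells⁺ U x<len y<len = ∈-concatMap⁺ _ {xs = upTo (length U)} (lose (∈-upTo⁺ x<len) (∈-map⁺ _ (∈-upTo⁺ y<len)))

InShape⇒∈cells : (U : Filling) {x y : ℕ} → InShape (map length U) x y → (x , y) ∈ cells U
InShape⇒∈cells U {x} (x<len , y<len) =
  ∈-cells⁺ U (subst (x <_) (length-map length U) x<len) (subst (_ <_) (at-map-length U x) y<len)

module _ (f : ℕ → ℕ → ℕ) (U : Filling) where

  length-mapCells : length (mapCells f U) ≡ length U
  length-mapCells = trans (length-map _ (upTo (length U))) (length-upTo (length U))

  row-mapCells : {x : ℕ} → x < length U → at [] (mapCells f U) x ≡ map (f x) (upTo (length (at [] U x)))
  row-mapCells = at-map-upTo [] _

  rowLength-mapCells : {x : ℕ} → x < length U → length (at [] (mapCells f U) x) ≡ length (at [] U x)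
  rowLength-mapCells {x} x<len rewrite row-mapCells x<len =
    trans (length-map _ (upTo (length (at [] U x)))) (length-upTo _)

  cells-mapCells : cells (mapCells f U) ≡ cells U
  cells-mapCells rewrite length-mapCells =
    cong concat (map-cong-local (tabulate λ x∈ →
      cong (λ n → map (_ ,_) (upTo n)) (rowLength-mapCells (∈-upTo⁻ x∈))))

  Label-mapCells : {x y : ℕ} → (x , y) ∈ cells U → Label (mapCells f U) x y ≡ f x y
  Label-mapCells {x} cell with ∈-cells⁻ U cell
  ... | x<len , y<len rewrite row-mapCells x<len = at-map-upTo 0 (f x) y<len

module _ {A : Set} (P Q : A → Bool) (P⇒Q : ∀ z → T (P z) → T (Q z)) where

  countᵇ-mono : (xs : List A) → countᵇ P xs ≤ countᵇ Q xs
  countᵇ-mono []       = z≤n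
  countᵇ-mono (x ∷ xs) with P x | Q x | P⇒Q x
  ... | true  | true  | _    = s≤s (countᵇ-mono xs)
  ... | true  | false | impl = ⊥-elim (impl _)
  ... | false | true  | _    = m≤n⇒m≤1+n (countᵇ-mono xs)
  ... | false | false | _    = countᵇ-mono xs

  countᵇ-mono-< : {xs : List A} {z : A} → z ∈ xs → ¬ T (P z) → T (Q z) → countᵇ P xs < countᵇ Q xs
  countᵇ-mono-< {x ∷ xs} (here refl) ¬Pz Qz with P x | Q x
  ... | true  | _     = ⊥-elim (¬Pz _)
  ... | false | true  = s≤s (countᵇ-mono xs)
  countᵇ-mono-< {x ∷ xs} (there z∈) ¬Pz Qz with P x | Q x | P⇒Q x
  ... | true  | true  | _    = s≤s (countᵇ-mono-< z∈ ¬Pz Qz)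
  ... | true  | false | impl = ⊥-elim (impl _)
  ... | false | true  | _    = m≤n⇒m≤1+n (countᵇ-mono-< z∈ ¬Pz Qz)
  ... | false | false | _    = countᵇ-mono-< z∈ ¬Pz Qz

countᵇ-∷ʳ-reject : {A : Set} (p : A → Bool) (xs : List A) {a : A} → ¬ T (p a) → countᵇ p (xs ∷ʳ a) ≡ countᵇ p xs
countᵇ-∷ʳ-reject p []       {a} ¬pa with p a
... | true  = ⊥-elim (¬pa _)
... | false = refl
countᵇ-∷ʳ-reject p (x ∷ xs) ¬pa with p x
... | true  = cong suc (countᵇ-∷ʳ-reject p xs ¬pa)
... | false = countᵇ-∷ʳ-reject p xs ¬pa

countᵇ-initial-segment-stable : (p : ℕ → Bool) {m n : ℕ} → m ≤ n → (∀ j → m < j → j ≤ n → ¬ T (p j)) →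
  countᵇ p (map suc (upTo n)) ≡ countᵇ p (map suc (upTo m))
countᵇ-initial-segment-stable p {m} m≤n none = go (≤⇒≤′ m≤n) none
  where
  go : {n : ℕ} → m ≤′ n → (∀ j → m < j → j ≤ n → ¬ T (p j)) → countᵇ p (map suc (upTo n)) ≡ countᵇ p (map suc (upTo m))
  go ≤′-refl _ = refl
  go {suc n} (≤′-step m≤′n) none = begin
    countᵇ p (map suc (upTo (suc n)))      ≡⟨ cong (λ l → countᵇ p (map suc l)) (sym (upTo-∷ʳ n)) ⟩
    countᵇ p (map suc (upTo n ++ [ n ]))   ≡⟨ cong (countᵇ p) (map-++ suc (upTo n) [ n ]) ⟩
    countᵇ p (map suc (upTo n) ∷ʳ suc n)   ≡⟨ countᵇ-∷ʳ-reject p (map suc (upTo n)) (none (suc n) (s≤s (≤′⇒≤ m≤′n)) ≤-refl) ⟩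
    countᵇ p (map suc (upTo n))            ≡⟨ go m≤′n (λ j m<j j≤n → none j m<j (m≤n⇒m≤1+n j≤n)) ⟩
    countᵇ p (map suc (upTo m))            ∎
    where open ≡-Reasoning

lexᵇ : ℕ → ℕ → ℕ → ℕ → Bool
lexᵇ u c u′ c′ = (u <ᵇ u′) ∨ ((u ≡ᵇ u′) ∧ (c <ᵇ c′))

data Lex (u c u′ c′ : ℕ) : Set where
  lex< : u < u′ → Lex u c u′ c′
  lex≡ : u ≡ u′ → c < c′ → Lex u c u′ c′

Lex-sound : ∀ u c u′ c′ → T (lexᵇ u c u′ c′) → Lex u c u′ c′
Lex-sound u c u′ c′ t with Equivalence.to T-∨ t
... | inj₁ u<u′ = lex< (<ᵇ⇒< u u′ u<u′)
... | inj₂ t′ with Equivalence.to T-∧ t′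
... | u≡u′ , c<c′ = lex≡ (≡ᵇ⇒≡ u u′ u≡u′) (<ᵇ⇒< c c′ c<c′)

Lex-complete : ∀ {u c u′ c′} → Lex u c u′ c′ → T (lexᵇ u c u′ c′)
Lex-complete (lex< u<u′) = Equivalence.from T-∨ (inj₁ (<⇒<ᵇ u<u′))
Lex-complete {u} {u′ = u′} (lex≡ u≡u′ c<c′) =
  Equivalence.from T-∨ (inj₂ (Equivalence.from T-∧ (≡⇒≡ᵇ u u′ u≡u′ , <⇒<ᵇ c<c′)))

Lex-trans : ∀ {u₁ c₁ u₂ c₂ u₃ c₃} → Lex u₁ c₁ u₂ c₂ → Lex u₂ c₂ u₃ c₃ → Lex u₁ c₁ u₃ c₃
Lex-trans (lex< p)      (lex< q)      = lex< (<-trans p q)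
Lex-trans (lex< p)      (lex≡ refl _) = lex< p
Lex-trans (lex≡ refl _) (lex< q)      = lex< q
Lex-trans (lex≡ refl p) (lex≡ refl q) = lex≡ refl (<-trans p q)

Lex-irrefl : ∀ u c → ¬ Lex u c u c
Lex-irrefl u c (lex< u<u)   = 1+n≰n u<u
Lex-irrefl u c (lex≡ _ c<c) = 1+n≰n c<c

Lex-weakenʳ : ∀ {u c u′ c′ c″} → c′ ≤ c″ → Lex u c u′ c′ → Lex u c u′ c″
Lex-weakenʳ _     (lex< u<u′)       = lex< u<u′
Lex-weakenʳ c′≤c″ (lex≡ u≡u′ c<c′) = lex≡ u≡u′ (<-≤-trans c<c′ c′≤c″)

record DescentWitness (V : Filling) (j : ℕ) : Set where
  field
    a b c d     : ℕ
    prev∈       : (a , b) ∈ cells V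
    curr∈       : (c , d) ∈ cells V
    prev≡       : suc (Label V a b) ≡ j
    curr≡       : Label V c d ≡ j
    weaklyEast  : d ≤ b

isDescent⇒witness : (V : Filling) {j : ℕ} → T (isDescent V j) → DescentWitness V j
isDescent⇒witness V t with find (any⁻ _ (cells V) t)
... | (a , b) , prev∈ , t′ with find (any⁻ _ (cells V) t′)
... | (c , d) , curr∈ , t″ with Equivalence.to T-∧ t″
... | prev≡ , t‴ with Equivalence.to T-∧ t‴
... | curr≡ , east = record
  { prev∈ = prev∈ ; curr∈ = curr∈
  ; prev≡ = ≡ᵇ⇒≡ _ _ prev≡ ; curr≡ = ≡ᵇ⇒≡ _ _ curr≡ ; weaklyEast = ≤ᵇ⇒≤ d b east }

-- stdLabel U x y is definitionally rank U (Label U x y) y.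
lexBefore : Filling → ℕ → ℕ → ℕ × ℕ → Bool
lexBefore U u c (a , b) = lexᵇ (Label U a b) b u c

rank : Filling → ℕ → ℕ → ℕ
rank U u c = suc (countᵇ (lexBefore U u c) (cells U))

descentsUpTo : Filling → ℕ → ℕ
descentsUpTo V n = countᵇ (isDescent V) (map suc (upTo n))

module _ (U : Filling) where

  rank-monoʳ : (u : ℕ) {c c′ : ℕ} → c ≤ c′ → rank U u c ≤ rank U u c′
  rank-monoʳ u {c} {c′} c≤c′ = s≤s (countᵇ-mono (lexBefore U u c) (lexBefore U u c′)
    (λ { (a , b) t → Lex-complete (Lex-weakenʳ c≤c′ (Lex-sound (Label U a b) b u c t)) }) (cells U))

  stdLabel-< : {a b u c : ℕ} → (a , b) ∈ cells U → Lex (Label U a b) b u c → stdLabel U a b < rank U u c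
  stdLabel-< {a} {b} {u} {c} cell lex = s≤s (countᵇ-mono-< (lexBefore U (Label U a b) b) (lexBefore U u c)
    (λ { (a′ , b′) t → Lex-complete (Lex-trans (Lex-sound (Label U a′ b′) b′ (Label U a b) b t) lex) })
    cell (λ t → Lex-irrefl (Label U a b) b (Lex-sound _ _ _ _ t)) (Lex-complete lex))

  cells-std : cells (std U) ≡ cells U
  cells-std = cells-mapCells (stdLabel U) U

  Label-std : {x y : ℕ} → (x , y) ∈ cells U → Label (std U) x y ≡ stdLabel U x y
  Label-std = Label-mapCells (stdLabel U) U

  Label-sweep-std : {x y : ℕ} → (x , y) ∈ cells U →
    Label (sweep (std U)) x y ≡ suc (descentsUpTo (std U) (stdLabel U x y))
  Label-sweep-std {x} {y} cell = begin
    Label (sweep (std U)) x y                      ≡⟨ Label-mapCells (sweepLabel (std U)) (std U) (subst ((x , y) ∈_) (sym cells-std) cell) ⟩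
    suc (descentsUpTo (std U) (Label (std U) x y)) ≡⟨ cong (suc ∘ descentsUpTo (std U)) (Label-std cell) ⟩
    suc (descentsUpTo (std U) (stdLabel U x y))    ∎
    where open ≡-Reasoning

  entry-within-block : {a b x y c d : ℕ} → (a , b) ∈ cells U → (x , y) ∈ cells U → (c , d) ∈ cells U →
    Label U x y ≡ Label U c d → stdLabel U x y ≤ stdLabel U a b → stdLabel U a b ≤ stdLabel U c d →
    Label U a b ≡ Label U x y
  entry-within-block {a} {b} {x} {y} ab∈ _ cd∈ xy≡cd xy≤ab ab≤cd with <-cmp (Label U a b) (Label U x y)
  ... | tri≈ _ ab≡xy _ = ab≡xy
  ... | tri< ab<xy _ _ = ⊥-elim (<⇒≱ (stdLabel-< {c = y} ab∈ (lex< ab<xy)) xy≤ab)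
  ... | tri> _ _ xy<ab = ⊥-elim (<⇒≱ (stdLabel-< {c = b} cd∈ (lex< (subst (_< Label U a b) xy≡cd xy<ab))) ab≤cd)

  no-descent-within-block : {x y c d j : ℕ} → (x , y) ∈ cells U → (c , d) ∈ cells U →
    Label U x y ≡ Label U c d → stdLabel U x y < j → j ≤ stdLabel U c d → ¬ T (isDescent (std U) j)
  no-descent-within-block {x} {y} {c} {d} {j} xy∈ cd∈ xy≡cd xy<j j≤cd t = 1+n≰n curr≤prev
    where
    open DescentWitness (isDescent⇒witness (std U) {j} t) renaming (c to c′; d to d′)
    prevU = subst ((a , b) ∈_) cells-std prev∈
    currU = subst ((c′ , d′) ∈_) cells-std curr∈
    prev : suc (stdLabel U a b) ≡ j
    prev = trans (cong suc (sym (Label-std prevU))) prev≡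
    curr : stdLabel U c′ d′ ≡ j
    curr = trans (sym (Label-std currU)) curr≡
    prev-entry : Label U a b ≡ Label U x y
    prev-entry = entry-within-block prevU xy∈ cd∈ xy≡cd
      (≤-pred (subst (stdLabel U x y <_) (sym prev) xy<j)) (<⇒≤ (subst (_≤ stdLabel U c d) (sym prev) j≤cd))
    curr-entry : Label U c′ d′ ≡ Label U x y
    curr-entry = entry-within-block currU xy∈ cd∈ xy≡cd
      (<⇒≤ (subst (stdLabel U x y <_) (sym curr) xy<j)) (subst (_≤ stdLabel U c d) (sym curr) j≤cd)
    curr≤prev : suc (stdLabel U a b) ≤ stdLabel U a b
    curr≤prev = begin
      suc (stdLabel U a b)              ≡⟨ trans prev (sym curr) ⟩
      rank U (Label U c′ d′) d′         ≡⟨ cong (λ u → rank U u d′) curr-entry ⟩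
      rank U (Label U x y) d′           ≤⟨ rank-monoʳ (Label U x y) weaklyEast ⟩
      rank U (Label U x y) b            ≡⟨ cong (λ u → rank U u b) (sym prev-entry) ⟩
      rank U (Label U a b) b            ∎
      where open ≤-Reasoning

  sweep-std-constant-on-ordered-entries : {x y c d : ℕ} → (x , y) ∈ cells U → (c , d) ∈ cells U →
    Label U x y ≡ Label U c d → stdLabel U x y ≤ stdLabel U c d →
    Label (sweep (std U)) x y ≡ Label (sweep (std U)) c d
  sweep-std-constant-on-ordered-entries {x} {y} {c} {d} xy∈ cd∈ xy≡cd xy≤cd = begin
    Label (sweep (std U)) x y                    ≡⟨ Label-sweep-std xy∈ ⟩
    suc (descentsUpTo (std U) (stdLabel U x y))  ≡⟨ cong suc (sym (countᵇ-initial-segment-stable (isDescent (std U)) xy≤cd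
                                                      (λ j xy<j j≤cd → no-descent-within-block xy∈ cd∈ xy≡cd xy<j j≤cd))) ⟩
    suc (descentsUpTo (std U) (stdLabel U c d))  ≡⟨ sym (Label-sweep-std cd∈) ⟩
    Label (sweep (std U)) c d                    ∎
    where open ≡-Reasoning

  sweep-std-constant-on-entries : {x y c d : ℕ} → (x , y) ∈ cells U → (c , d) ∈ cells U →
    Label U x y ≡ Label U c d → Label (sweep (std U)) x y ≡ Label (sweep (std U)) c d
  sweep-std-constant-on-entries {x} {y} {c} {d} xy∈ cd∈ xy≡cd with ≤-total (stdLabel U x y) (stdLabel U c d)
  ... | inj₁ xy≤cd = sweep-std-constant-on-ordered-entries xy∈ cd∈ xy≡cd xy≤cd
  ... | inj₂ cd≤xy = sym (sweep-std-constant-on-ordered-entries cd∈ xy∈ (sym xy≡cd) cd≤xy)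

lemma2p6 : (λ′ : List ℕ) → Partition λ′ → (w : ℕ → ℕ) → InS∞ w → (U : Filling) → EG λ′ w U → (x y c d : ℕ) → InShape λ′ x y → InShape λ′ c d → Label U x y ≡ Label U c d → Label (sweep (std U)) x y ≡ Label (sweep (std U)) c d
lemma2p6 λ′ _ _ _ U (shape , _) x y c d xy∈λ cd∈λ xy≡cd =
  sweep-std-constant-on-entries U (cell xy∈λ) (cell cd∈λ) xy≡cd
  where
  cell : {a b : ℕ} → InShape λ′ a b → (a , b) ∈ cells U
  cell {a} {b} ab∈λ = InShape⇒∈cells U (subst (λ μ → InShape μ a b) (sym shape) ab∈λ)
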